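{- For every integer $k\ge 1$, the multigraph $G_k^*$ has pathwidth at least $k$.
   Context: For $k\ge1$, let $T_k$ be a complete ternary tree of height $k-1$ (every non-leaf vertex has exactly three children and every root-to-leaf path has exactly $k-1$ edges) rooted at a vertex $r_k$. The multigraph $G_k^*$ is obtained from $T_k$ by adding a new vertex $a_k$, one edge between $a_k$ and $r_k$, and three parallel edges between $a_k$ and each leaf of $T_k$ (for $k=1$, $r_k$ is a leaf, so $a_k r_k$ has four parallel edges). (Equivalently, $G_k^*$ is the plane dual of the outerplane graph $G_k$ defined recursively: $G_1$ is a $4$-cycle with any edge as root edge, and $G_k$ is a $4$-cycle with edges $e^1,e^2,e^3,e^4$ where a copy of $G_{k-1}$ is glued along its root edge to each of $e^1,e^2,e^3$, with root edge $e^4$; $a_k$ corresponds to the outer face.) A path-decomposition of a multigraph $H$ is a sequence $(X_0,\dots,X_s)$ of subsets of $V(H)$ such that for every vertex $v$ the indices $i$ with $v\in X_i$ form a non-empty interval, and every edge has both ends in some $X_i$; its width is $\max_i|X_i|-1$, and the pathwidth of $H$ is the minimum width of a path-decomposition. -}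

module Defs where

open import Level using (0ℓ)
open import Data.Nat using (ℕ; zero; suc; _⊔_; _∸_; _≤_)
open import Data.Fin using (Fin) renaming (_≤_ to _≤ᶠ_)
import Data.Fin as F
open import Data.Maybe using (Maybe; just; nothing)
open import Data.List using (List; length)
open import Data.List.Membership.Propositional using (_∈_)
open import Data.List.Relation.Unary.Unique.Propositional using (Unique)
open import Data.Product using (Σ; _×_; _,_; proj₁; proj₂; ∃-syntax)

-- Multigraphs: a vertex type, an edge type, and the ends of each edge.
-- Parallel edges are distinct elements of E with the same ends.

record Multigraph : Set₁ where
  field
    V    : Set
    E    : Set
    ends : E → V × V

-- Path-decompositions (X_0, ..., X_s).  Bags are duplicate-free lists
-- of vertices, so |X_i| is the length of the list.

record PathDecomposition (H : Multigraph) : Set where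
  open Multigraph H
  field
    s        : ℕ
    bag      : Fin (suc s) → List V
    bagSet   : ∀ i → Unique (bag i)
    nonEmpty : ∀ (v : V) → ∃[ i ] (v ∈ bag i)
    interval : ∀ (v : V) (i j l : Fin (suc s)) → i ≤ᶠ j → j ≤ᶠ l →
               v ∈ bag i → v ∈ bag l → v ∈ bag j
    covers   : ∀ (e : E) → ∃[ i ] (proj₁ (ends e) ∈ bag i × proj₂ (ends e) ∈ bag i)

maxF : ∀ n → (Fin n → ℕ) → ℕ
maxF zero    f = 0
maxF (suc n) f = f F.zero ⊔ maxF n (λ i → f (F.suc i))

width : ∀ {H} → PathDecomposition H → ℕ
width D = maxF (suc s) (λ i → length (bag i)) ∸ 1
  where open PathDecomposition D

PathwidthAtLeast : Multigraph → ℕ → Set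
PathwidthAtLeast H k = ∀ (D : PathDecomposition H) → k ≤ width D

-- Complete ternary tree T_k of height k-1 (TV 0 is empty).
-- T_{k+1} = root with three copies of T_k below it.

data TV : ℕ → Set where
  root : ∀ {k} → TV (suc k)
  sub  : ∀ {k} → Fin 3 → TV k → TV (suc k)

data Leaf : ∀ {k} → TV k → Set where
  leaf1 : Leaf (root {0})
  leafS : ∀ {k} {i : Fin 3} {v : TV k} → Leaf v → Leaf (sub i v)

data TE : ∀ {k} → TV k → TV k → Set where
  down   : ∀ {k} (i : Fin 3) → TE (root {suc k}) (sub i root)
  inside : ∀ {k} (i : Fin 3) {u v : TV k} → TE u v → TE (sub i u) (sub i v)

-- Edges of G_k^*; the apex a_k is `nothing`, tree vertices are `just v`.
data GE : ∀ {k} → Maybe (TV k) → Maybe (TV k) → Set where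
  tree     : ∀ {k} {u v : TV k} → TE u v → GE (just u) (just v)
  apexRoot : ∀ {k} → GE nothing (just (root {k}))
  apexLeaf : ∀ {k} {v : TV k} → Leaf v → Fin 3 → GE nothing (just v)

GStar : ℕ → Multigraph
GStar k = record
  { V    = Maybe (TV k)
  ; E    = Σ (Maybe (TV k) × Maybe (TV k)) (λ p → GE (proj₁ p) (proj₂ p))
  ; ends = proj₁
  }

-- A path-decomposition turns each vertex into an interval of bag indices, and a connected
-- set of vertices into a union of pairwise-overlapping intervals, hence again an interval.
-- Induction on the height of a ternary tree T whose root and leaves all meet a convex
-- region U of indices (initially the interval of the apex): some bag contains either
-- height + 2 vertices of T, or height + 1 vertices of T at an index in U.  For the
-- inductive step apply the hypothesis to each of the three subtrees, with U enlarged by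
-- the interval of the root.  Of the three bags obtained, one, at index t, lies between
-- the other two.  The other two subtrees, together with U (reached through their leaves)
-- or together with the root, form two connected sets spanning an interval through t, so
-- the bag at t contains either a vertex of another subtree or both U and the root;
-- either way it gains a vertex.
module Submission where

open import Level using (0ℓ)
open import Data.Nat using (ℕ; zero; suc; _≤_; _∸_; z≤n; s≤s)
import Data.Nat.Properties as ℕ
open import Data.Fin using (Fin)
import Data.Fin as F
open import Data.Fin.Patterns using (0F; 1F; 2F)
import Data.Fin.Properties as FP
open import Data.Maybe using (just; nothing)
open import Data.Maybe.Properties using (just-injective)
open import Data.List using (List; []; _∷_; length; map)
open import Data.List.Properties using (length-map; length-removeAt′)
open import Data.List.Membership.Propositional using (_∈_; _─_)
open import Data.List.Relation.Unary.Any using (here; there)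
open import Data.List.Relation.Unary.All as All using (All; []; _∷_)
import Data.List.Relation.Unary.All.Properties as All
open import Data.List.Relation.Unary.AllPairs using ([]; _∷_)
open import Data.List.Relation.Unary.Unique.Propositional using (Unique)
import Data.List.Relation.Unary.Unique.Propositional.Properties as Unique
open import Data.Product using (Σ; ∃; _×_; _,_; proj₁; proj₂)
open import Data.Sum as Sum using (_⊎_; inj₁; inj₂)
open import Data.Unit using (⊤; tt)
open import Function using (_∘_)
open import Relation.Binary.Bundles using (TotalOrder)
open import Relation.Binary.PropositionalEquality using (_≡_; _≢_; refl; sym; cong; subst)
open import Relation.Nullary using (contradiction)
open import Relation.Unary using (Pred; _⊆_; _∪_; ⋃; _≬_; _≐_)

open import Defs

module _ {a} {A : Set a} where

  ∈-─ : ∀ {x y : A} {ys} (x∈ys : x ∈ ys) → y ∈ ys → x ≢ y → y ∈ ys ─ x∈ys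
  ∈-─ (here refl)  (here refl)  x≢y = contradiction refl x≢y
  ∈-─ (here _)     (there y∈ys) _   = y∈ys
  ∈-─ (there _)    (here refl)  _   = here refl
  ∈-─ (there x∈ys) (there y∈ys) x≢y = there (∈-─ x∈ys y∈ys x≢y)

  unique⇒length≤ : ∀ {xs ys : List A} → Unique xs → All (_∈ ys) xs → length xs ≤ length ys
  unique⇒length≤ []                          []              = z≤n
  unique⇒length≤ {ys = ys} (x≢xs ∷ xs-unique) (x∈ys ∷ xs⊆ys) =
    subst (_ ≤_) (sym (length-removeAt′ ys _))
      (s≤s (unique⇒length≤ xs-unique
              (All.zipWith (λ (x≢y , y∈ys) → ∈-─ x∈ys y∈ys x≢y) (x≢xs , xs⊆ys))))

≤-maxF : ∀ n (f : Fin n → ℕ) i → f i ≤ maxF n f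
≤-maxF (suc n) f F.zero    = ℕ.m≤m⊔n _ _
≤-maxF (suc n) f (F.suc i) = ℕ.≤-trans (≤-maxF n (f ∘ F.suc) i) (ℕ.m≤n⊔m _ _)

module Convexity {a ℓ₁ ℓ₂} (O : TotalOrder a ℓ₁ ℓ₂) where

  open TotalOrder O using (total) renaming (Carrier to I; _≤_ to _≼_)

  Convex : ∀ {p} → Pred I p → Set _
  Convex C = ∀ {i j l} → i ≼ j → j ≼ l → C i → C l → C j

  Convex-resp-≐ : ∀ {p q} {C : Pred I p} {D : Pred I q} → C ≐ D → Convex C → Convex D
  Convex-resp-≐ (C⊆D , D⊆C) convex i≤j j≤l x y = C⊆D (convex i≤j j≤l (D⊆C x) (D⊆C y))

  Convex-star : ∀ {p q r} {A : Set r} {C : Pred I p} {D : A → Pred I q} →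
                Convex C → (∀ α → Convex (D α)) → (∀ {α j} → D α j → C ≬ D α) →
                Convex (C ∪ ⋃ A D)
  Convex-star cC cD meet i≤j j≤l (inj₁ ci) (inj₁ cl) = inj₁ (cC i≤j j≤l ci cl)
  Convex-star cC cD meet {j = j} i≤j j≤l (inj₁ ci) (inj₂ (β , dl))
    with meet dl
  ... | q , cq , dq with total j q
  ...   | inj₁ j≤q = inj₁ (cC i≤j j≤q ci cq)
  ...   | inj₂ q≤j = inj₂ (β , cD β q≤j j≤l dq dl)
  Convex-star cC cD meet {j = j} i≤j j≤l (inj₂ (α , di)) (inj₁ cl)
    with meet di
  ... | p , cp , dp with total j p
  ...   | inj₁ j≤p = inj₂ (α , cD α i≤j j≤p di dp)
  ...   | inj₂ p≤j = inj₁ (cC p≤j j≤l cp cl)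
  Convex-star cC cD meet {j = j} i≤j j≤l (inj₂ (α , di)) (inj₂ (β , dl))
    with meet di | meet dl
  ... | p , cp , dp | q , cq , dq with total j p | total q j
  ...   | inj₁ j≤p | _        = inj₂ (α , cD α i≤j j≤p di dp)
  ...   | inj₂ _   | inj₁ q≤j = inj₂ (β , cD β q≤j j≤l dq dl)
  ...   | inj₂ p≤j | inj₂ j≤q = inj₁ (cC p≤j j≤q cp cq)

  Convex-∪ : ∀ {p q} {C : Pred I p} {D : Pred I q} → Convex C → Convex D → C ≬ D → Convex (C ∪ D)
  Convex-∪ {C = C} {D} cC cD C≬D =
    Convex-resp-≐ (to , from) (Convex-star {A = ⊤} cC (λ _ → cD) (λ _ → C≬D))
    where
      to : C ∪ ⋃ ⊤ (λ _ → D) ⊆ C ∪ D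
      to (inj₁ c)       = inj₁ c
      to (inj₂ (_ , d)) = inj₂ d
      from : C ∪ D ⊆ C ∪ ⋃ ⊤ (λ _ → D)
      from (inj₁ c) = inj₁ c
      from (inj₂ d) = inj₂ (tt , d)

  middle : ∀ {p} (t : Fin 3 → I) →
           ∃ λ m → ∀ {C : Pred I p} → Convex C → (∀ α → α ≢ m → C (t α)) → C (t m)
  middle t with total (t 0F) (t 1F) | total (t 1F) (t 2F) | total (t 0F) (t 2F)
  ... | inj₁ 0≤1 | inj₁ 1≤2 | _        = 1F , λ cC on → cC 0≤1 1≤2 (on 0F λ ()) (on 2F λ ())
  ... | inj₁ _   | inj₂ 2≤1 | inj₁ 0≤2 = 2F , λ cC on → cC 0≤2 2≤1 (on 0F λ ()) (on 1F λ ())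
  ... | inj₁ 0≤1 | inj₂ _   | inj₂ 2≤0 = 0F , λ cC on → cC 2≤0 0≤1 (on 2F λ ()) (on 1F λ ())
  ... | inj₂ 1≤0 | inj₁ _   | inj₁ 0≤2 = 0F , λ cC on → cC 1≤0 0≤2 (on 1F λ ()) (on 2F λ ())
  ... | inj₂ _   | inj₁ 1≤2 | inj₂ 2≤0 = 2F , λ cC on → cC 1≤2 2≤0 (on 1F λ ()) (on 0F λ ())
  ... | inj₂ 1≤0 | inj₂ 2≤1 | _        = 1F , λ cC on → cC 2≤1 1≤0 (on 2F λ ()) (on 0F λ ())

sub-injectiveˡ : ∀ {n} {i j : Fin 3} {u v : TV n} → sub i u ≡ sub j v → i ≡ j
sub-injectiveˡ refl = refl

sub-injectiveʳ : ∀ {n} {i j : Fin 3} {u v : TV n} → sub i u ≡ sub j v → u ≡ v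
sub-injectiveʳ refl = refl

someLeaf : ∀ n → Σ (TV (suc n)) Leaf
someLeaf zero    = root , leaf1
someLeaf (suc n) = sub 0F (proj₁ (someLeaf n)) , leafS (proj₂ (someLeaf n))

module TreeImages {a ℓ₁ ℓ₂} (O : TotalOrder a ℓ₁ ℓ₂) {V : Set}
                  (occ : V → Pred (TotalOrder.Carrier O) 0ℓ)
                  (occ-convex : ∀ v → Convexity.Convex O (occ v)) where

  open TotalOrder O using () renaming (Carrier to I)
  open Convexity O

  Support : ∀ {m} → (TV m → V) → Pred I 0ℓ
  Support f j = ∃ λ v → occ (f v) j

  EdgesMet : ∀ {m} → (TV m → V) → Set a
  EdgesMet f = ∀ {u v} → TE u v → occ (f u) ≬ occ (f v)

  root≬child : ∀ {m} (f : TV (suc (suc m)) → V) → EdgesMet f →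
               ∀ i → occ (f root) ≬ Support (f ∘ sub i)
  root≬child f edges i with edges (down i)
  ... | j , r , c = j , r , root , c

  Support-convex : ∀ m (f : TV m → V) → EdgesMet f → Convex (Support f)
  Support-convex zero    f _     _ _ (() , _)
  Support-convex (suc m) f edges =
    Convex-resp-≐ (to , from)
      (Convex-star (occ-convex (f root))
                   (λ i → Support-convex m (f ∘ sub i) (edges ∘ inside i))
                   root≬nonempty)
    where
      root≬nonempty : ∀ {i j} → Support (f ∘ sub i) j → occ (f root) ≬ Support (f ∘ sub i)
      root≬nonempty {i} (root    , _) = root≬child f edges i
      root≬nonempty {i} (sub _ _ , _) = root≬child f edges i
      to : occ (f root) ∪ ⋃ (Fin 3) (λ i → Support (f ∘ sub i)) ⊆ Support f
      to (inj₁ r)           = root , r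
      to (inj₂ (i , v , o)) = sub i v , o
      from : Support f ⊆ occ (f root) ∪ ⋃ (Fin 3) (λ i → Support (f ∘ sub i))
      from (root    , r) = inj₁ r
      from (sub i v , o) = inj₂ (i , v , o)

  record Attached {m} (f : TV (suc m) → V) (U : Pred I 0ℓ) : Set a where
    field
      edges    : EdgesMet f
      atRoot   : U ≬ occ (f root)
      atLeaves : ∀ {v} → Leaf v → U ≬ occ (f v)

  record Crowded {m} (f : TV m → V) (U : Pred I 0ℓ) (k : ℕ) : Set a where
    constructor crowdedAt
    field
      index   : I
      members : List (TV m)
      unique  : Unique members
      occurs  : All (λ v → occ (f v) index) members
      -- an index in U counts as one more member (in the end, U is where the apex lies)
      large   : suc k ≤ length members ⊎ (U index × k ≤ length members)

  Crowded-support : ∀ {m f U k} (c : Crowded {m} f U (suc k)) → Support f (Crowded.index c)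
  Crowded-support (crowdedAt _ []      _ _       (inj₁ ()))
  Crowded-support (crowdedAt _ []      _ _       (inj₂ (_ , ())))
  Crowded-support (crowdedAt _ (v ∷ _) _ (o ∷ _) _) = v , o

  module Lift {m} {f : TV (suc m) → V} {U : Pred I 0ℓ} {k} {i : Fin 3}
              (c : Crowded (f ∘ sub i) (U ∪ occ (f root)) k) where

    open Crowded c

    lifted : List (TV (suc m))
    lifted = map (sub i) members

    lifted-unique : Unique lifted
    lifted-unique = Unique.map⁺ sub-injectiveʳ unique

    lifted-occurs : All (λ v → occ (f v) index) lifted
    lifted-occurs = All.map⁺ occurs

    lifted-large : suc k ≤ length lifted ⊎ ((U ∪ occ (f root)) index × k ≤ length lifted)
    lifted-large = subst (λ n → suc k ≤ n ⊎ (_ × k ≤ n)) (sym (length-map (sub i) members)) large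

    root∉lifted : All (root ≢_) lifted
    root∉lifted = All.map⁺ (All.universal (λ _ ()) members)

    sibling∉lifted : ∀ {α} {v : TV m} → α ≢ i → All (sub α v ≢_) lifted
    sibling∉lifted α≢i = All.map⁺ (All.universal (λ _ → α≢i ∘ sub-injectiveˡ) members)

    viaRoot : U index → occ (f root) index → Crowded f U (suc k)
    viaRoot u r = crowdedAt index (root ∷ lifted) (root∉lifted ∷ lifted-unique) (r ∷ lifted-occurs)
                    (Sum.map s≤s (λ (_ , k≤) → u , s≤s k≤) lifted-large)

    viaSibling : ∀ {α} {v : TV m} → α ≢ i → occ (f (sub α v)) index → Crowded f U (suc k)
    viaSibling {α} {v} α≢i o = fromLarge lifted-large
      where
        withSibling : suc (suc k) ≤ suc (length lifted) ⊎ (U index × suc k ≤ suc (length lifted)) →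
                      Crowded f U (suc k)
        withSibling = crowdedAt index (sub α v ∷ lifted)
                        (sibling∉lifted α≢i ∷ lifted-unique) (o ∷ lifted-occurs)
        fromLarge : suc k ≤ length lifted ⊎ ((U ∪ occ (f root)) index × k ≤ length lifted) →
                    Crowded f U (suc k)
        fromLarge (inj₁ k<)            = withSibling (inj₁ (s≤s k<))
        fromLarge (inj₂ (inj₁ u , k≤)) = withSibling (inj₂ (u , s≤s k≤))
        fromLarge (inj₂ (inj₂ r , k≤)) =
          crowdedAt index (root ∷ sub α v ∷ lifted)
            (((λ ()) ∷ root∉lifted) ∷ sibling∉lifted α≢i ∷ lifted-unique) (r ∷ o ∷ lifted-occurs)
            (inj₁ (s≤s (s≤s k≤)))

  Siblings : ∀ {m} → (TV (suc m) → V) → Fin 3 → Pred I 0ℓ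
  Siblings f i = ⋃ (Σ (Fin 3) (_≢ i)) (λ (α , _) → Support (f ∘ sub α))

  Siblings-convex-∪ : ∀ {m} {f : TV (suc m) → V} {C : Pred I 0ℓ} → EdgesMet f → Convex C →
                      (∀ α → C ≬ Support (f ∘ sub α)) → ∀ i → Convex (C ∪ Siblings f i)
  Siblings-convex-∪ {f = f} edges C-convex C≬child i =
    Convex-star C-convex (λ (α , _) → Support-convex _ (f ∘ sub α) (edges ∘ inside α))
                (λ {(α , _)} _ → C≬child α)

  crowded-step : ∀ {n k} {f : TV (suc (suc n)) → V} {U} → Convex U → Attached f U →
                 (∀ i → Crowded (f ∘ sub i) (U ∪ occ (f root)) (suc k)) → Crowded f U (suc (suc k))
  crowded-step {n} {k} {f} {U} U-convex attached child with middle {p = 0ℓ} (Crowded.index ∘ child)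
  ... | m , between =
    grow (between (Siblings-convex-∪ edges U-convex U≬child m) (inSiblings {U}))
         (between (Siblings-convex-∪ edges (occ-convex (f root)) (root≬child f edges) m)
                  (inSiblings {occ (f root)}))
    where
      open Attached attached
      open Lift {f = f} {i = m} (child m)

      U≬child : ∀ α → U ≬ Support (f ∘ sub α)
      U≬child α with atLeaves (leafS {i = α} (proj₂ (someLeaf n)))
      ... | j , u , l = j , u , _ , l

      inSiblings : ∀ {C : Pred I 0ℓ} α → α ≢ m → (C ∪ Siblings f m) (Crowded.index (child α))
      inSiblings α α≢m = inj₂ ((α , α≢m) , Crowded-support (child α))

      grow : (U ∪ Siblings f m) (Crowded.index (child m)) →
             (occ (f root) ∪ Siblings f m) (Crowded.index (child m)) → Crowded f U (suc (suc k))
      grow (inj₂ ((_ , α≢m) , _ , o)) _                          = viaSibling α≢m o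
      grow (inj₁ _)                  (inj₂ ((_ , α≢m) , _ , o)) = viaSibling α≢m o
      grow (inj₁ u)                  (inj₁ r)                   = viaRoot u r

  crowded : ∀ n (f : TV (suc n) → V) {U} → Convex U → Attached f U → Crowded f U (suc n)
  crowded zero f _ attached with Attached.atRoot attached
  ... | j , u , r = crowdedAt j (root ∷ []) ([] ∷ []) (r ∷ []) (inj₂ (u , s≤s z≤n))
  crowded (suc n) f {U} U-convex attached =
    crowded-step U-convex attached λ i →
      crowded n (f ∘ sub i) (Convex-∪ U-convex (occ-convex (f root)) atRoot) (childAttached i)
    where
      open Attached attached

      childAttached : ∀ i → Attached (f ∘ sub i) (U ∪ occ (f root))
      childAttached i = record
        { edges    = edges ∘ inside i
        ; atRoot   = let j , r , c = edges (down i) in j , inj₂ r , c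
        ; atLeaves = λ leaf → let j , u , l = atLeaves (leafS leaf) in j , inj₁ u , l
        }

≤-width : ∀ {H} (D : PathDecomposition H) i → length (PathDecomposition.bag D i) ∸ 1 ≤ width D
≤-width D i = ℕ.∸-monoˡ-≤ 1 (≤-maxF _ (λ i → length (bag i)) i)
  where open PathDecomposition D

module _ {n} (D : PathDecomposition (GStar (suc n))) where

  open PathDecomposition D
  open TreeImages (FP.≤-totalOrder (suc s)) (λ v j → v ∈ bag j) (λ v → interval v _ _ _)

  tree-attached : Attached just (λ j → nothing ∈ bag j)
  tree-attached = record
    { edges    = λ e → covers (_ , tree e)
    ; atRoot   = covers (_ , apexRoot)
    ; atLeaves = λ leaf → covers (_ , apexLeaf leaf 0F)
    }

  large-bag : ∃ λ j → suc (suc n) ≤ length (bag j)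
  large-bag with crowded n just (interval nothing _ _ _) tree-attached
  ... | crowdedAt j L L-unique L-occurs large = j , bag-large large
    where
      just-L-unique : Unique (map just L)
      just-L-unique = Unique.map⁺ just-injective L-unique

      just-L⊆bag : All (_∈ bag j) (map just L)
      just-L⊆bag = All.map⁺ L-occurs

      |L|≤|bag| : length L ≤ length (bag j)
      |L|≤|bag| = subst (_≤ length (bag j)) (length-map just L)
                    (unique⇒length≤ just-L-unique just-L⊆bag)

      bag-large : suc (suc n) ≤ length L ⊎ (nothing ∈ bag j × suc n ≤ length L) →
                  suc (suc n) ≤ length (bag j)
      bag-large (inj₁ n+2≤|L|)              = ℕ.≤-trans n+2≤|L| |L|≤|bag|
      bag-large (inj₂ (apex∈bag , n+1≤|L|)) =
        ℕ.≤-trans (s≤s n+1≤|L|)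
          (subst (_≤ length (bag j)) (cong suc (length-map just L))
            (unique⇒length≤ (All.map⁺ (All.universal (λ _ ()) L) ∷ just-L-unique)
                            (apex∈bag ∷ just-L⊆bag)))

lemma3p5 : ∀ (k : ℕ) → 1 ≤ k → PathwidthAtLeast (GStar k) k
lemma3p5 (suc n) _ D with large-bag D
... | j , n+2≤|bag| = ℕ.≤-trans (ℕ.∸-monoˡ-≤ 1 n+2≤|bag|) (≤-width D j)
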